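{- Let $n\ge 1$, let $S_n=K_{1,n}$ be the star with $n+1$ vertices, and let $H$ be any dispersable bipartite graph. Then $S_n+_Q H$ is dispersable, i.e. $\operatorname{mbt}(S_n+_Q H)=\Delta(S_n+_Q H)$.
   Context: Matching book embedding: the vertices are placed in a linear order along a spine and each edge is assigned to a page (half-plane bounded by the spine) so that no two edges on the same page cross and every vertex is incident with at most one edge on each page. $\operatorname{mbt}(G)$ is the minimum number of pages of a matching book embedding of $G$. $G$ is dispersable if $\operatorname{mbt}(G)=\Delta(G)$, where $\Delta$ denotes maximum degree. For a graph $G$, $Q(G)$ is obtained by inserting a new vertex into each edge of $G$ and then joining two new vertices whenever their edges of $G$ share an endpoint; thus $V(Q(G))=V(G)\cup E(G)$. The $Q$-sum $G+_Q H$ has vertex set $(V(G)\cup E(G))\times V(H)$. Two vertices $(u_1,u_2)$ and $(v_1,v_2)$ are adjacent if and only if either $u_1=v_1\in V(G)$ and $u_2v_2\in E(H)$, or $u_2=v_2$ and $u_1v_1\in E(Q(G))$. -}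

module Defs where

open import Data.Nat using (ℕ; zero; suc; _≤_; _<_)
open import Data.Fin using (Fin; zero; suc; _≟_) renaming (_<_ to _<ᶠ_)
open import Data.Bool using (Bool; true; false; _∧_; _∨_; not)
open import Data.Product using (Σ; Σ-syntax; ∃; _×_; _,_; proj₁; proj₂)
open import Data.Sum using (_⊎_; inj₁; inj₂)
open import Data.Empty using (⊥)
open import Function.Bundles using (_↔_)
open import Relation.Nullary using (¬_; yes; no)
open import Relation.Nullary.Decidable using (⌊_⌋)
open import Relation.Binary.PropositionalEquality using (_≡_; refl; sym; _≢_)

record Graph : Set₁ where
  field
    V       : Set
    adj     : V → V → Bool
    adj-sym : ∀ u v → adj u v ≡ adj v u
    adj-irr : ∀ v → adj v v ≡ false

open Graph public

Edge : (G : Graph) → V G → V G → Set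
Edge G u v = adj G u v ≡ true

record FinGraph (n : ℕ) : Set where
  field
    fadj     : Fin n → Fin n → Bool
    fadj-sym : ∀ u v → fadj u v ≡ fadj v u
    fadj-irr : ∀ v → fadj v v ≡ false

open FinGraph public

toGraph : ∀ {n} → FinGraph n → Graph
toGraph {n} G = record
  { V = Fin n ; adj = fadj G ; adj-sym = fadj-sym G ; adj-irr = fadj-irr G }

HasDegree : (G : Graph) → V G → ℕ → Set
HasDegree G v d = (Σ (V G) (λ u → Edge G v u)) ↔ Fin d

-- Δ(G) = D : every vertex has degree ≤ D, and D is attained
-- (or D = 0, the convention for the graph without vertices)
IsMaxDegree : Graph → ℕ → Set
IsMaxDegree G D =
  (∀ v d → HasDegree G v d → d ≤ D) ×
  ((D ≡ 0) ⊎ (Σ (V G) λ v → HasDegree G v D))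

Bipartite : Graph → Set
Bipartite G = Σ (V G → Bool) λ c → ∀ u v → Edge G u v → c u ≢ c v

record MBE (G : Graph) (k : ℕ) : Set where
  field
    pos      : V G → ℕ
    pos-inj  : ∀ u v → pos u ≡ pos v → u ≡ v
    page     : ∀ u v → Edge G u v → Fin k
    page-sym : ∀ u v (e : Edge G u v) (e' : Edge G v u) → page u v e ≡ page v u e'
    matching : ∀ u v w (e : Edge G u v) (e' : Edge G u w) →
               page u v e ≡ page u w e' → v ≡ w
    noncross : ∀ a b c d (e : Edge G a c) (e' : Edge G b d) →
               pos a < pos b → pos b < pos c → pos c < pos d →
               page a c e ≢ page b d e'

IsMbt : Graph → ℕ → Set
IsMbt G k = MBE G k × (∀ j → MBE G j → k ≤ j)

Dispersable : Graph → Set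
Dispersable G = Σ ℕ λ D → IsMaxDegree G D × IsMbt G D

starAdj : ∀ {n} → Fin (suc n) → Fin (suc n) → Bool
starAdj zero    zero    = false
starAdj zero    (suc _) = true
starAdj (suc _) zero    = true
starAdj (suc _) (suc _) = false

star : (n : ℕ) → FinGraph (suc n)
star n = record { fadj = starAdj ; fadj-sym = s ; fadj-irr = i }
  where
  s : ∀ u v → starAdj u v ≡ starAdj v u
  s zero zero = refl
  s zero (suc _) = refl
  s (suc _) zero = refl
  s (suc _) (suc _) = refl
  i : ∀ v → starAdj v v ≡ false
  i zero = refl
  i (suc _) = refl

eqb : ∀ {n} → Fin n → Fin n → Bool
eqb i j = ⌊ i ≟ j ⌋

eqb-sym : ∀ {n} (i j : Fin n) → eqb i j ≡ eqb j i
eqb-sym i j with i ≟ j | j ≟ i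
... | yes _ | yes _ = refl
... | no _  | no _  = refl
... | yes p | no q  with q (sym p)
... | ()
eqb-sym i j | no q | yes p with q (sym p)
... | ()

eqb-refl : ∀ {n} (i : Fin n) → eqb i i ≡ true
eqb-refl i with i ≟ i
... | yes _ = refl
... | no q with q refl
... | ()

E : ∀ {n} → FinGraph n → Set
E {n} G = Σ[ i ∈ Fin n ] Σ[ j ∈ Fin n ] (i <ᶠ j × fadj G i j ≡ true)

src tgt : ∀ {n} (G : FinGraph n) → E G → Fin n
src G (i , _ , _) = i
tgt G (_ , j , _) = j

QV : ∀ {n} → FinGraph n → Set
QV {n} G = Fin n ⊎ E G

private
  swap-lemma : ∀ a b c d → not (a ∧ d) ∧ (a ∨ b ∨ c ∨ d) ≡ not (a ∧ d) ∧ (a ∨ c ∨ b ∨ d)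
  swap-lemma true b c d = refl
  swap-lemma false true true d = refl
  swap-lemma false true false d = refl
  swap-lemma false false true d = refl
  swap-lemma false false false d = refl

-- adjacency of Q(G): a vertex is joined to the edges incident to it,
-- two distinct edges are joined iff they share an endpoint
qadj : ∀ {n} (G : FinGraph n) → QV G → QV G → Bool
qadj G (inj₁ v) (inj₁ w) = false
qadj G (inj₁ v) (inj₂ e) = eqb v (src G e) ∨ eqb v (tgt G e)
qadj G (inj₂ e) (inj₁ v) = eqb v (src G e) ∨ eqb v (tgt G e)
qadj G (inj₂ e) (inj₂ f) =
  not (eqb (src G e) (src G f) ∧ eqb (tgt G e) (tgt G f)) ∧
  (eqb (src G e) (src G f) ∨ eqb (src G e) (tgt G f) ∨ eqb (tgt G e) (src G f) ∨ eqb (tgt G e) (tgt G f))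

qadj-sym : ∀ {n} (G : FinGraph n) u v → qadj G u v ≡ qadj G v u
qadj-sym G (inj₁ v) (inj₁ w) = refl
qadj-sym G (inj₁ v) (inj₂ e) = refl
qadj-sym G (inj₂ e) (inj₁ v) = refl
qadj-sym G (inj₂ (i , j , _)) (inj₂ (i' , j' , _))
  rewrite eqb-sym i i' | eqb-sym j j' | eqb-sym i j' | eqb-sym j i' =
  swap-lemma (eqb i' i) (eqb j' i) (eqb i' j) (eqb j' j)

qadj-irr : ∀ {n} (G : FinGraph n) v → qadj G v v ≡ false
qadj-irr G (inj₁ v) = refl
qadj-irr G (inj₂ (i , j , _)) rewrite eqb-refl i | eqb-refl j = refl

Q : ∀ {n} → FinGraph n → Graph
Q G = record { V = QV G ; adj = qadj G ; adj-sym = qadj-sym G ; adj-irr = qadj-irr G }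

sameV : ∀ {n} {G : FinGraph n} → QV G → QV G → Bool
sameV (inj₁ v) (inj₁ w) = eqb v w
sameV (inj₁ _) (inj₂ _) = false
sameV (inj₂ _) (inj₁ _) = false
sameV (inj₂ _) (inj₂ _) = false

sameV-sym : ∀ {n} {G : FinGraph n} (u v : QV G) → sameV {G = G} u v ≡ sameV {G = G} v u
sameV-sym (inj₁ v) (inj₁ w) = eqb-sym v w
sameV-sym (inj₁ _) (inj₂ _) = refl
sameV-sym (inj₂ _) (inj₁ _) = refl
sameV-sym (inj₂ _) (inj₂ _) = refl

QSumV : ∀ {n m} → FinGraph n → FinGraph m → Set
QSumV {n} {m} G H = QV G × Fin m

qsumAdj : ∀ {n m} (G : FinGraph n) (H : FinGraph m) → QSumV G H → QSumV G H → Bool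
qsumAdj G H (u₁ , u₂) (v₁ , v₂) =
  (sameV {G = G} u₁ v₁ ∧ fadj H u₂ v₂) ∨ (eqb u₂ v₂ ∧ qadj G u₁ v₁)

qsumAdj-sym : ∀ {n m} (G : FinGraph n) (H : FinGraph m) u v →
              qsumAdj G H u v ≡ qsumAdj G H v u
qsumAdj-sym G H (u₁ , u₂) (v₁ , v₂)
  rewrite sameV-sym {G = G} u₁ v₁ | fadj-sym H u₂ v₂ | eqb-sym u₂ v₂ | qadj-sym G u₁ v₁ = refl

qsumAdj-irr : ∀ {n m} (G : FinGraph n) (H : FinGraph m) v → qsumAdj G H v v ≡ false
qsumAdj-irr G H (v₁ , v₂) rewrite fadj-irr H v₂ | qadj-irr G v₁ with sameV {G = G} v₁ v₁ | eqb v₂ v₂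
... | true  | true  = refl
... | true  | false = refl
... | false | true  = refl
... | false | false = refl

_+Q_ : ∀ {n m} → FinGraph n → FinGraph m → Graph
G +Q H = record
  { V = QSumV G H ; adj = qsumAdj G H
  ; adj-sym = qsumAdj-sym G H ; adj-irr = qsumAdj-irr G H }

module Submission where

-- Q(S_n) is a clique K_{n+1} on the centre and the n edge vertices e_j, with a
-- pendant leaf l_j at each e_j. Giving the centre index 0 and e_j, l_j index j,
-- and putting the edge between indices i and j on page i + j mod n+1, embeds
-- Q(S_n) in n+1 pages: two edges on one page at a vertex, or two crossing
-- clique edges on one page, would have index sums differing by less than n+1.
-- S_n +_Q H is laid out copy by copy along an embedding of H in Δ(H) pages, the
-- copies over one colour class of H being reversed, so that two copies of an
-- edge of H at different vertices of S_n nest rather than cross. An edge of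
-- H on a page p > 0 of H goes to a fresh page, one on page 0 to the page i of
-- Q(S_n), where i is the index of its vertex of S_n: no edge of Q(S_n) at that
-- vertex or passing over it uses page i. The n + max(1, Δ(H)) pages used are
-- the degree of the centre (or of e_1 if H has no edges), and any embedding
-- needs at least the maximum degree, since the edges at a vertex lie on
-- distinct pages.

open import Defs
open import Data.Nat using (ℕ; zero; suc; pred; _+_; _*_; _∸_; _≤_; _<_; z≤n; s≤s; z<s; NonZero)
open import Data.Nat.Properties
open import Data.Nat.DivMod using (_%_; _/_; m≡m%n+[m/n]*n; m<n⇒m%n≡m; m%n<n)
open import Data.Nat.Divisibility using (_∣_; divides; >⇒∤)
open import Data.Fin using (Fin; zero; suc; toℕ; fromℕ<) renaming (_≟_ to _≟ᶠ_)
open import Data.Fin.Properties using (toℕ-injective; toℕ<n; +↔⊎; injective⇒≤; fromℕ<-cong; fromℕ<-injective)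
open import Data.Bool using (Bool; true; false; _∧_; _∨_; not)
import Data.Bool.Properties as Bool
open import Data.Product using (Σ; _×_; _,_; proj₁; proj₂)
open import Data.Sum using (_⊎_; inj₁; inj₂)
open import Data.Sum.Function.Propositional using (_⊎-↔_)
open import Data.Empty using (⊥; ⊥-elim)
open import Function using (_∘_)
open import Function.Bundles using (_↔_; Inverse; Injection; mk↔ₛ′)
open import Function.Properties.Inverse using (↔-sym; ↔-trans; ↔⇒↣)
open import Axiom.UniquenessOfIdentityProofs using (module Decidable⇒UIP)
open import Relation.Nullary using (¬_; yes; contradiction)
open import Relation.Binary.Definitions using (tri<; tri≈; tri>)
open import Relation.Binary.PropositionalEquality

eqb⇒≡ : ∀ {k} {i j : Fin k} → eqb i j ≡ true → i ≡ j
eqb⇒≡ {i = i} {j} p with i ≟ᶠ j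
... | yes i≡j = i≡j

∧-true⁻ : ∀ {a b} → a ∧ b ≡ true → a ≡ true × b ≡ true
∧-true⁻ {true} p = refl , p

∨-true⁻ : ∀ {a b} → a ∨ b ≡ true → a ≡ true ⊎ b ≡ true
∨-true⁻ {true}  _ = inj₁ refl
∨-true⁻ {false} p = inj₂ p

x∨[y∧false]≡true⇒x≡true : ∀ {a b} → a ∨ (b ∧ false) ≡ true → a ≡ true
x∨[y∧false]≡true⇒x≡true {true}          _ = refl
x∨[y∧false]≡true⇒x≡true {false} {true}  ()
x∨[y∧false]≡true⇒x≡true {false} {false} ()

%-injective-window : ∀ {s t N} .{{_ : NonZero N}} → s ≤ t → t < s + N → s % N ≡ t % N → s ≡ t
%-injective-window {s} {t} {N} s≤t t<s+N s≡t =
  ≤-antisym s≤t (m∸n≡0⇒m≤n (gap≡0 (t ∸ s) N∣gap (m<n+o⇒m∸n<o t s t<s+N)))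
  where
  N∣gap : N ∣ t ∸ s
  N∣gap = divides (t / N ∸ s / N) (begin
    t ∸ s                                       ≡⟨ cong₂ _∸_ (m≡m%n+[m/n]*n t N) (m≡m%n+[m/n]*n s N) ⟩
    (t % N + t / N * N) ∸ (s % N + s / N * N)   ≡⟨ cong (λ r → (r + t / N * N) ∸ (s % N + s / N * N)) (sym s≡t) ⟩
    (s % N + t / N * N) ∸ (s % N + s / N * N)   ≡⟨ [m+n]∸[m+o]≡n∸o (s % N) _ _ ⟩
    t / N * N ∸ s / N * N                       ≡⟨ *-distribʳ-∸ N (t / N) (s / N) ⟨
    (t / N ∸ s / N) * N                         ∎)
    where open ≡-Reasoning
  gap≡0 : ∀ d → N ∣ d → d < N → d ≡ 0
  gap≡0 zero    _   _   = refl
  gap≡0 (suc d) N∣d d<N = contradiction N∣d (>⇒∤ d<N)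

%-cancel-window : ∀ i {a b N} .{{_ : NonZero N}} → a ≤ b → b < N → (i + a) % N ≡ (i + b) % N → a ≡ b
%-cancel-window i {a} {b} {N} a≤b b<N eq =
  +-cancelˡ-≡ i a b (%-injective-window (+-monoʳ-≤ i a≤b) window eq)
  where
  window : i + b < i + a + N
  window = subst (i + b <_) (sym (+-assoc i a N)) (+-monoʳ-< i (<-≤-trans b<N (m≤n+m N a)))

+-cancelˡ-% : ∀ i {a b N} .{{_ : NonZero N}} → a < N → b < N → (i + a) % N ≡ (i + b) % N → a ≡ b
+-cancelˡ-% i {a} {b} a<N b<N eq with ≤-total a b
... | inj₁ a≤b = %-cancel-window i a≤b b<N eq
... | inj₂ b≤a = sym (%-cancel-window i b≤a a<N (sym eq))

crossing-sums-%-distinct : ∀ {a b c d N} .{{_ : NonZero N}} → a < b → b < c → c < d → d < N →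
                           (a + c) % N ≢ (b + d) % N
crossing-sums-%-distinct {a} {b} {c} {d} {N} a<b b<c c<d d<N eq =
  <-irrefl (%-injective-window (<⇒≤ ac<bd) bd<ac+N eq) ac<bd
  where
  ac<bd : a + c < b + d
  ac<bd = +-mono-< a<b c<d
  bd<ac+N : b + d < a + c + N
  bd<ac+N = <-≤-trans (+-mono-< b<c d<N) (+-monoˡ-≤ N (m≤n+m c a))

covering-sum-%-distinct : ∀ {a i b N} .{{_ : NonZero N}} → a ≤ i → i < b → b < N → (a + b) % N ≢ i
covering-sum-%-distinct {a} {i} {b} {N} a≤i i<b b<N eq =
  <-irrefl (%-injective-window (<⇒≤ i<a+b) (+-mono-≤-< a≤i b<N) i≡) i<a+b
  where
  i<a+b : i < a + b
  i<a+b = <-≤-trans i<b (m≤n+m b a)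
  i≡ : i % N ≡ (a + b) % N
  i≡ = trans (m<n⇒m%n≡m (<-trans i<b b<N)) (sym eq)

module Lexicographic (W : ℕ) where

  lex-< : ∀ {q q' r r'} → q < q' → r < W → q * W + r < q' * W + r'
  lex-< {q} {q'} {r} {r'} q<q' r<W = begin-strict
    q * W + r    <⟨ +-monoʳ-< (q * W) r<W ⟩
    q * W + W    ≡⟨ +-comm (q * W) W ⟩
    suc q * W    ≤⟨ *-monoˡ-≤ W q<q' ⟩
    q' * W       ≤⟨ m≤m+n (q' * W) r' ⟩
    q' * W + r'  ∎
    where open ≤-Reasoning

  lex-<-cases : ∀ {q q' r r'} → r < W → r' < W → q * W + r < q' * W + r' → q < q' ⊎ (q ≡ q' × r < r')
  lex-<-cases {q} {q'} {r} {r'} r<W r'<W lt with <-cmp q q'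
  ... | tri< q<q' _ _ = inj₁ q<q'
  ... | tri≈ _ refl _ = inj₂ (refl , +-cancelˡ-< (q * W) r r' lt)
  ... | tri> _ _ q'<q = contradiction lt (<-asym (lex-< q'<q r'<W))

  lex-injective : ∀ {q q' r r'} → r < W → r' < W → q * W + r ≡ q' * W + r' → q ≡ q' × r ≡ r'
  lex-injective {q} {q'} {r} {r'} r<W r'<W eq with <-cmp q q'
  ... | tri< q<q' _ _ = contradiction eq (<⇒≢ (lex-< q<q' r<W))
  ... | tri≈ _ refl _ = refl , +-cancelˡ-≡ (q * W) r r' eq
  ... | tri> _ _ q'<q = contradiction eq (>⇒≢ (lex-< q'<q r'<W))

  lex-≤ : ∀ {q q' r r'} → r < W → r' < W → q * W + r < q' * W + r' → q ≤ q'
  lex-≤ r<W r'<W lt with lex-<-cases r<W r'<W lt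
  ... | inj₁ q<q'       = <⇒≤ q<q'
  ... | inj₂ (refl , _) = ≤-refl

  lex-between : ∀ {q q' r₁ r r₂} → r₁ < W → r < W → r₂ < W →
                q * W + r₁ < q' * W + r → q' * W + r < q * W + r₂ → q' ≡ q
  lex-between r₁<W r<W r₂<W lt₁ lt₂ = ≤-antisym (lex-≤ r<W r₂<W lt₂) (lex-≤ r₁<W r<W lt₁)

  lex-between-residues : ∀ {q q' r₁ r r₂} → r₁ < W → r < W → r₂ < W →
                         q * W + r₁ < q' * W + r → q' * W + r < q * W + r₂ → r₁ < r × r < r₂
  lex-between-residues {q} {q'} r₁<W r<W r₂<W lt₁ lt₂ with lex-between {q} {q'} r₁<W r<W r₂<W lt₁ lt₂
  ... | refl = +-cancelˡ-< (q * W) _ _ lt₁ , +-cancelˡ-< (q * W) _ _ lt₂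

orient : ℕ → Bool → ℕ → ℕ
orient W true  s = s
orient W false s = W ∸ suc s

module _ {W : ℕ} where

  orient-< : ∀ b {s} → s < W → orient W b s < W
  orient-< true  s<W = s<W
  orient-< false s<W = ∸-monoʳ-< z<s s<W

  orient-injective : ∀ b {s t} → s < W → t < W → orient W b s ≡ orient W b t → s ≡ t
  orient-injective true  _   _   eq = eq
  orient-injective false s<W t<W eq = suc-injective (∸-cancelˡ-≡ s<W t<W eq)

  orient-false-reverses : ∀ {s t} → orient W false s < orient W false t → t < s
  orient-false-reverses lt = ≤-pred (∸-cancelʳ-< {o = W} lt)

  orient-opposite : ∀ {b b' s t} → b ≢ b' → orient W b s < orient W b t → orient W b' s < orient W b' t → ⊥
  orient-opposite {true}  {true}  b≢b' _  _  = b≢b' refl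
  orient-opposite {false} {false} b≢b' _  _  = b≢b' refl
  orient-opposite {true}  {false} _    lt lt' = <-asym lt (orient-false-reverses lt')
  orient-opposite {false} {true}  _    lt lt' = <-asym lt' (orient-false-reverses lt)

Neighbour : (G : Graph) → V G → Set
Neighbour G u = Σ (V G) (Edge G u)

neighbour-≡ : ∀ {G u} {x y : Neighbour G u} → proj₁ x ≡ proj₁ y → x ≡ y
neighbour-≡ {x = v , e} {.v , e'} refl = cong (v ,_) (Decidable⇒UIP.≡-irrelevant Bool._≟_ e e')

Edge-sym : ∀ {G u v} → Edge G u v → Edge G v u
Edge-sym {G} {u} {v} e = trans (adj-sym G v u) e

Edge-irrefl : ∀ {G} v → ¬ Edge G v v
Edge-irrefl {G} v e with trans (sym (adj-irr G v)) e
... | ()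

degree≤pages : ∀ {G k v d} → MBE G k → HasDegree G v d → d ≤ k
degree≤pages {G} {k} {v} {d} M deg = injective⇒≤ pageAt-injective
  where
  open MBE M
  neighbour : Fin d → Neighbour G v
  neighbour = Inverse.from deg
  pageAt : Fin d → Fin k
  pageAt i = page v (proj₁ (neighbour i)) (proj₂ (neighbour i))
  pageAt-injective : ∀ {i j} → pageAt i ≡ pageAt j → i ≡ j
  pageAt-injective eq = Injection.injective (↔⇒↣ (↔-sym deg))
    (neighbour-≡ {G} (matching v _ _ (proj₂ (neighbour _)) (proj₂ (neighbour _)) eq))

module _ {G : Graph} {k : ℕ} (M : MBE G k) where
  open MBE M

  same-page-weakly-crossing : ∀ a b c d (e : Edge G a c) (e' : Edge G b d) →
                              pos a ≤ pos b → pos b ≤ pos c → pos c ≤ pos d →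
                              page a c e ≡ page b d e' → a ≡ b × c ≡ d
  same-page-weakly-crossing a b c d e e' ab bc cd eq
    with m≤n⇒m<n∨m≡n ab | m≤n⇒m<n∨m≡n bc | m≤n⇒m<n∨m≡n cd
  ... | inj₂ a≡b | _ | _ with pos-inj a b a≡b
  ...   | refl = refl , matching a c d e e' eq
  same-page-weakly-crossing a b c d e e' ab bc cd eq | inj₁ a<b | inj₂ b≡c | _ with pos-inj b c b≡c
  ...   | refl = contradiction (cong pos (matching b a d (Edge-sym {G} e) e' (trans (page-sym b a _ e) eq)))
                   (<⇒≢ (<-≤-trans a<b cd))
  same-page-weakly-crossing a b c d e e' ab bc cd eq | inj₁ a<b | inj₁ b<c | inj₂ c≡d with pos-inj c d c≡d
  ...   | refl = contradiction (cong pos (matching c a b (Edge-sym {G} e) (Edge-sym {G} e')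
                   (trans (page-sym c a _ e) (trans eq (page-sym b c e' _))))) (<⇒≢ a<b)
  same-page-weakly-crossing a b c d e e' ab bc cd eq | inj₁ a<b | inj₁ b<c | inj₁ c<d =
    contradiction eq (noncross a b c d e e' a<b b<c c<d)

record MBEℕ (G : Graph) (k : ℕ) : Set where
  field
    pos      : V G → ℕ
    pos-inj  : ∀ u v → pos u ≡ pos v → u ≡ v
    page     : ∀ u v → Edge G u v → ℕ
    page-<   : ∀ u v (e : Edge G u v) → page u v e < k
    page-sym : ∀ u v (e : Edge G u v) (e' : Edge G v u) → page u v e ≡ page v u e'
    matching : ∀ u v w (e : Edge G u v) (e' : Edge G u w) →
               page u v e ≡ page u w e' → v ≡ w
    noncross : ∀ a b c d (e : Edge G a c) (e' : Edge G b d) →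
               pos a < pos b → pos b < pos c → pos c < pos d →
               page a c e ≢ page b d e'

MBEℕ⇒MBE : ∀ {G k} → MBEℕ G k → MBE G k
MBEℕ⇒MBE {G} {k} M = record
  { pos      = pos
  ; pos-inj  = pos-inj
  ; page     = λ u v e → fromℕ< (page-< u v e)
  ; page-sym = λ u v e e' → fromℕ<-cong _ _ (page-sym u v e e') (page-< u v e) (page-< v u e')
  ; matching = λ u v w e e' eq → matching u v w e e' (fromℕ<-injective _ _ (page-< u v e) (page-< u w e') eq)
  ; noncross = λ a b c d e e' ab bc cd eq →
      noncross a b c d e e' ab bc cd (fromℕ<-injective _ _ (page-< a c e) (page-< b d e') eq)
  }
  where open MBEℕ M

dispersable-empty : ∀ {G} → ¬ V G → Dispersable G
dispersable-empty {G} empty = 0 , ((λ v → ⊥-elim (empty v)) , inj₁ refl) , (emptyMBE , λ _ _ → z≤n)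
  where
  emptyMBE : MBE G 0
  emptyMBE = record
    { pos = λ v → ⊥-elim (empty v) ; pos-inj = λ v → ⊥-elim (empty v)
    ; page = λ v → ⊥-elim (empty v) ; page-sym = λ v → ⊥-elim (empty v)
    ; matching = λ v → ⊥-elim (empty v) ; noncross = λ v → ⊥-elim (empty v) }

dispersable-by : ∀ {G D} → MBE G D → (v : V G) → HasDegree G v D → Dispersable G
dispersable-by M v deg =
  _ , ((λ _ _ → degree≤pages M) , inj₂ (v , deg)) , (M , λ _ M' → degree≤pages M' deg)

module _ {n m : ℕ} (G : FinGraph n) (H : FinGraph m) where

  +Q-vertex-neighbours : ∀ v h → Neighbour (G +Q H) (inj₁ v , h) ↔
                                 (Neighbour (Q G) (inj₁ v) ⊎ Neighbour (toGraph H) h)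
  +Q-vertex-neighbours v h = mk↔ₛ′ to from to-from from-to
    where
    copy-edge : ∀ {w h'} → Edge (G +Q H) (inj₁ v , h) (inj₁ w , h') → eqb v w ∧ fadj H h h' ≡ true
    copy-edge {w} {h'} = x∨[y∧false]≡true⇒x≡true {eqb v w ∧ fadj H h h'}
    to : Neighbour (G +Q H) (inj₁ v , h) → Neighbour (Q G) (inj₁ v) ⊎ Neighbour (toGraph H) h
    to ((inj₁ w , h') , e) = inj₂ (h' , proj₂ (∧-true⁻ (copy-edge e)))
    to ((inj₂ f , h') , e) = inj₁ (inj₂ f , proj₂ (∧-true⁻ e))
    from : Neighbour (Q G) (inj₁ v) ⊎ Neighbour (toGraph H) h → Neighbour (G +Q H) (inj₁ v , h)
    from (inj₁ (inj₂ f , e)) = (inj₂ f , h) , cong₂ _∧_ (eqb-refl h) e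
    from (inj₂ (h' , e))     = (inj₁ v , h') , cong (_∨ (eqb h h' ∧ false)) (cong₂ _∧_ (eqb-refl v) e)
    to-from : ∀ y → to (from y) ≡ y
    to-from (inj₁ (inj₂ f , _)) = cong inj₁ (neighbour-≡ {Q G} {inj₁ v} refl)
    to-from (inj₂ (h' , _))     = cong inj₂ (neighbour-≡ {toGraph H} {h} refl)
    from-to : ∀ x → from (to x) ≡ x
    from-to ((inj₁ w , h') , e) =
      neighbour-≡ {G +Q H} {inj₁ v , h} (cong (λ u → inj₁ u , h') (eqb⇒≡ (proj₁ (∧-true⁻ (copy-edge e)))))
    from-to ((inj₂ f , h') , e) =
      neighbour-≡ {G +Q H} {inj₁ v , h} (cong (inj₂ f ,_) (eqb⇒≡ (proj₁ (∧-true⁻ e))))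

  +Q-vertex-degree : ∀ {v h d k} → HasDegree (Q G) (inj₁ v) d → HasDegree (toGraph H) h k →
                     HasDegree (G +Q H) (inj₁ v , h) (d + k)
  +Q-vertex-degree {v} {h} dQ dH =
    ↔-trans (+Q-vertex-neighbours v h) (↔-trans (dQ ⊎-↔ dH) (↔-sym +↔⊎))

  +Q-edge-neighbours : ∀ e h → Neighbour (G +Q H) (inj₂ e , h) ↔ Neighbour (Q G) (inj₂ e)
  +Q-edge-neighbours e h = mk↔ₛ′ to from to-from from-to
    where
    fibre-edge : ∀ {y h'} → Edge (G +Q H) (inj₂ e , h) (y , h') → eqb h h' ∧ qadj G (inj₂ e) y ≡ true
    fibre-edge {inj₁ _} p = p
    fibre-edge {inj₂ _} p = p
    to : Neighbour (G +Q H) (inj₂ e , h) → Neighbour (Q G) (inj₂ e)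
    to ((y , h') , p) = y , proj₂ (∧-true⁻ (fibre-edge {y} p))
    from : Neighbour (Q G) (inj₂ e) → Neighbour (G +Q H) (inj₂ e , h)
    from (y , p) = (y , h) , trans (cong (sameV {G = G} (inj₂ e) y ∧ fadj H h h ∨_) (cong₂ _∧_ (eqb-refl h) p))
                                   (Bool.∨-zeroʳ _)
    to-from : ∀ y → to (from y) ≡ y
    to-from _ = neighbour-≡ {Q G} {inj₂ e} refl
    from-to : ∀ x → from (to x) ≡ x
    from-to ((y , h') , p) =
      neighbour-≡ {G +Q H} {inj₂ e , h} (cong (y ,_) (eqb⇒≡ (proj₁ (∧-true⁻ (fibre-edge {y} p)))))

  +Q-edge-degree : ∀ {e h d} → HasDegree (Q G) (inj₂ e) d → HasDegree (G +Q H) (inj₂ e , h) d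
  +Q-edge-degree {e} {h} dQ = ↔-trans (+Q-edge-neighbours e h) dQ

module QStar (n : ℕ) where

  N : ℕ
  N = suc n

  S : FinGraph N
  S = star n

  spoke : Fin n → E S
  spoke j = zero , suc j , s≤s z≤n , refl

  spoke-index : E S → Fin n
  spoke-index (zero  , suc j , _  , _)  = j
  spoke-index (zero  , zero  , _  , ())
  spoke-index (suc _ , zero  , () , _)
  spoke-index (suc _ , suc _ , _  , ())

  spoke-spoke-index : ∀ e → spoke (spoke-index e) ≡ e
  spoke-spoke-index (zero  , suc j , lt , refl) =
    cong (λ lt → zero , suc j , lt , refl) (<-irrelevant _ lt)
  spoke-spoke-index (zero  , zero  , _  , ())
  spoke-spoke-index (suc _ , zero  , () , _)
  spoke-spoke-index (suc _ , suc _ , _  , ())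

  -- clique zero is the centre of S_n, clique (suc j) the vertex of Q(S_n) subdividing
  -- the edge 0—(suc j), and leaf j the leaf suc j.
  data Node : Set where
    clique : Fin N → Node
    leaf   : Fin n → Node

  vnode : Fin N → Node
  vnode zero    = clique zero
  vnode (suc j) = leaf j

  node : QV S → Node
  node (inj₁ v) = vnode v
  node (inj₂ e) = clique (suc (spoke-index e))

  unnode : Node → QV S
  unnode (clique zero)    = inj₁ zero
  unnode (clique (suc j)) = inj₂ (spoke j)
  unnode (leaf j)         = inj₁ (suc j)

  unnode-node : ∀ x → unnode (node x) ≡ x
  unnode-node (inj₁ zero)    = refl
  unnode-node (inj₁ (suc j)) = refl
  unnode-node (inj₂ e)       = cong inj₂ (spoke-spoke-index e)

  node-injective : ∀ {x y} → node x ≡ node y → x ≡ y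
  node-injective {x} {y} eq = trans (sym (unnode-node x)) (trans (cong unnode eq) (unnode-node y))

  data QEdge : Node → Node → Set where
    clique-edge : ∀ {i i'} → i ≢ i' → QEdge (clique i) (clique i')
    leaf-edgeˡ  : ∀ j → QEdge (leaf j) (clique (suc j))
    leaf-edgeʳ  : ∀ j → QEdge (clique (suc j)) (leaf j)

  QEdge-sym : ∀ {x y} → QEdge x y → QEdge y x
  QEdge-sym (clique-edge i≢i') = clique-edge (i≢i' ∘ sym)
  QEdge-sym (leaf-edgeˡ j)     = leaf-edgeʳ j
  QEdge-sym (leaf-edgeʳ j)     = leaf-edgeˡ j

  qedge-unnode : ∀ x y → qadj S (unnode x) (unnode y) ≡ true → QEdge x y
  qedge-unnode (clique zero)    (clique zero)    ()
  qedge-unnode (clique zero)    (clique (suc j)) _ = clique-edge λ ()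
  qedge-unnode (clique zero)    (leaf j)         ()
  qedge-unnode (clique (suc i)) (clique zero)    _ = clique-edge λ ()
  qedge-unnode (clique (suc i)) (clique (suc j)) p = clique-edge λ { refl → not-eqb-refl (suc i) p }
    where
    not-eqb-refl : ∀ (i : Fin N) → not (eqb i i) ∧ true ≢ true
    not-eqb-refl i rewrite eqb-refl i = λ ()
  qedge-unnode (clique (suc i)) (leaf j)         p with eqb⇒≡ {i = suc j} {suc i} p
  ... | refl = leaf-edgeʳ j
  qedge-unnode (leaf i)         (clique zero)    ()
  qedge-unnode (leaf i)         (clique (suc j)) p with eqb⇒≡ {i = suc i} {suc j} p
  ... | refl = leaf-edgeˡ i
  qedge-unnode (leaf i)         (leaf j)         ()

  qedge : ∀ x y → Edge (Q S) x y → QEdge (node x) (node y)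
  qedge x y e = qedge-unnode (node x) (node y)
    (subst₂ (λ a b → qadj S a b ≡ true) (sym (unnode-node x)) (sym (unnode-node y)) e)

  -- Within a copy of Q(S_n) the spine reads centre, e₁, l₁, e₂, l₂, …, so each leaf edge
  -- joins spine neighbours and the clique edges are ordered by idx.
  idx : Node → ℕ
  idx (clique i) = toℕ i
  idx (leaf j)   = suc (toℕ j)

  tag : Node → ℕ
  tag (clique _) = 0
  tag (leaf _)   = 1

  slot : Node → ℕ
  slot x = idx x * 2 + tag x

  qpage : Node → Node → ℕ
  qpage x y = (idx x + idx y) % N

  open Lexicographic 2

  idx-< : ∀ x → idx x < N
  idx-< (clique i) = toℕ<n i
  idx-< (leaf j)   = s≤s (toℕ<n j)

  tag-< : ∀ x → tag x < 2
  tag-< (clique _) = s≤s z≤n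
  tag-< (leaf _)   = s≤s (s≤s z≤n)

  slot-< : ∀ x → slot x < N * 2
  slot-< x = <-≤-trans (lex-< {r' = 0} (idx-< x) (tag-< x)) (≤-reflexive (+-identityʳ (N * 2)))

  slot-injective : ∀ {x y} → slot x ≡ slot y → x ≡ y
  slot-injective {x} {y} eq = from-idx-tag x y (lex-injective (tag-< x) (tag-< y) eq)
    where
    from-idx-tag : ∀ x y → idx x ≡ idx y × tag x ≡ tag y → x ≡ y
    from-idx-tag (clique i) (clique i') (eq , _) = cong clique (toℕ-injective eq)
    from-idx-tag (leaf j)   (leaf j')   (eq , _) = cong leaf (toℕ-injective (suc-injective eq))
    from-idx-tag (clique _) (leaf _)    (_ , ())
    from-idx-tag (leaf _)   (clique _)  (_ , ())

  qpage-sym : ∀ x y → qpage x y ≡ qpage y x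
  qpage-sym x y = cong (_% N) (+-comm (idx x) (idx y))

  neighbour-idx-injective : ∀ {x y z} → QEdge x y → QEdge x z → idx y ≡ idx z → y ≡ z
  neighbour-idx-injective (clique-edge _)  (clique-edge _)  eq = cong clique (toℕ-injective eq)
  neighbour-idx-injective (clique-edge i≢) (leaf-edgeʳ j)   eq = contradiction (toℕ-injective eq) (i≢ ∘ sym)
  neighbour-idx-injective (leaf-edgeʳ j)   (clique-edge i≢) eq = contradiction (toℕ-injective (sym eq)) (i≢ ∘ sym)
  neighbour-idx-injective (leaf-edgeˡ j)   (leaf-edgeˡ _)   _  = refl
  neighbour-idx-injective (leaf-edgeʳ j)   (leaf-edgeʳ _)   _  = refl

  qpage-matching : ∀ {x y z} → QEdge x y → QEdge x z → qpage x y ≡ qpage x z → y ≡ z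
  qpage-matching {x} {y} {z} q q' eq =
    neighbour-idx-injective q q' (+-cancelˡ-% (idx x) (idx-< y) (idx-< z) eq)

  vertex-neighbour-idx≢0 : ∀ v {y} → QEdge (vnode v) y → idx y ≢ 0
  vertex-neighbour-idx≢0 zero    (clique-edge 0≢i) eq = 0≢i (sym (toℕ-injective eq))
  vertex-neighbour-idx≢0 (suc j) (leaf-edgeˡ _)    ()

  qpage-avoids-vertex : ∀ v {y} → QEdge (vnode v) y → qpage (vnode v) y ≢ idx (vnode v)
  qpage-avoids-vertex v {y} q eq = vertex-neighbour-idx≢0 v q
    (+-cancelˡ-% (idx (vnode v)) (idx-< y) z<s (trans eq (sym i+0%N≡i)))
    where
    i+0%N≡i : (idx (vnode v) + 0) % N ≡ idx (vnode v)
    i+0%N≡i = trans (cong (_% N) (+-identityʳ (idx (vnode v)))) (m<n⇒m%n≡m (idx-< (vnode v)))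

  no-slot-between : ∀ {x y z} → idx x ≡ idx y → slot x < slot z → slot z < slot y → ⊥
  no-slot-between {x} {y} {z} eq xz zy
    with lex-between-residues {idx x} {idx z} (tag-< x) (tag-< z) (tag-< y) xz
           (subst (λ q → slot z < q * 2 + tag y) (sym eq) zy)
  ... | xz' , zy' = no-two-steps xz' zy' (tag-< y)
    where
    no-two-steps : ∀ {a b c} → a < b → b < c → c < 2 → ⊥
    no-two-steps (s≤s _) (s≤s (s≤s _)) (s≤s (s≤s ()))

  clique-slot-< : ∀ {a b} → slot (clique a) < slot (clique b) → toℕ a < toℕ b
  clique-slot-< lt with lex-<-cases (s≤s z≤n) (s≤s z≤n) lt
  ... | inj₁ a<b = a<b
  ... | inj₂ (_ , ())

  qpage-noncrossing : ∀ {x y z w} → QEdge x y → QEdge z w →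
                      slot x < slot z → slot z < slot y → slot y < slot w → qpage x y ≢ qpage z w
  qpage-noncrossing {x} {y} {z} (leaf-edgeˡ _) _ xz zy _ = ⊥-elim (no-slot-between {x} {y} {z} refl xz zy)
  qpage-noncrossing {x} {y} {z} (leaf-edgeʳ _) _ xz zy _ = ⊥-elim (no-slot-between {x} {y} {z} refl xz zy)
  qpage-noncrossing {y = y} {z} {w} (clique-edge _) (leaf-edgeˡ _) _ zy yw =
    ⊥-elim (no-slot-between {z} {w} {y} refl zy yw)
  qpage-noncrossing {y = y} {z} {w} (clique-edge _) (leaf-edgeʳ _) _ zy yw =
    ⊥-elim (no-slot-between {z} {w} {y} refl zy yw)
  qpage-noncrossing (clique-edge {a} {c} _) (clique-edge {b} {d} _) xz zy yw =
    crossing-sums-%-distinct {toℕ a} {toℕ b} {toℕ c} {toℕ d} (clique-slot-< xz) (clique-slot-< zy) (clique-slot-< yw) (toℕ<n d)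

  qpage-nonseparating : ∀ v {x y} → QEdge x y → slot x < slot (vnode v) → slot (vnode v) < slot y →
                        qpage x y ≢ idx (vnode v)
  qpage-nonseparating zero    _                 ()  _
  qpage-nonseparating (suc j) {x} {y} (leaf-edgeˡ _) xv vy = ⊥-elim (no-slot-between {x} {y} {leaf j} refl xv vy)
  qpage-nonseparating (suc j) {x} {y} (leaf-edgeʳ _) xv vy = ⊥-elim (no-slot-between {x} {y} {leaf j} refl xv vy)
  qpage-nonseparating (suc j) (clique-edge {a} {b} _) xv vy =
    covering-sum-%-distinct {toℕ a} (lex-≤ (s≤s z≤n) (tag-< (leaf j)) xv) j<b (toℕ<n b)
    where
    j<b : suc (toℕ j) < toℕ b
    j<b with lex-<-cases (tag-< (leaf j)) (s≤s z≤n) vy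
    ... | inj₁ lt = lt
    ... | inj₂ (_ , ())

  W : ℕ
  W = N * 2

  oslot : Bool → Node → ℕ
  oslot b x = orient W b (slot x)

  oriented-noncrossing : ∀ b {x y z w} → QEdge x y → QEdge z w →
                         oslot b x < oslot b z → oslot b z < oslot b y → oslot b y < oslot b w →
                         qpage x y ≢ qpage z w
  oriented-noncrossing true  q q' = qpage-noncrossing q q'
  oriented-noncrossing false {x} {y} {z} {w} q q' xz zy yw eq =
    qpage-noncrossing (QEdge-sym q') (QEdge-sym q)
      (orient-false-reverses {W} yw) (orient-false-reverses {W} zy) (orient-false-reverses {W} xz)
      (trans (qpage-sym w z) (trans (sym eq) (qpage-sym x y)))

  oriented-nonseparating : ∀ b v {x y} → QEdge x y → oslot b x < oslot b (vnode v) → oslot b (vnode v) < oslot b y →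
                           qpage x y ≢ idx (vnode v)
  oriented-nonseparating true  v q = qpage-nonseparating v q
  oriented-nonseparating false v {x} {y} q xv vy eq =
    qpage-nonseparating v (QEdge-sym q) (orient-false-reverses {W} vy) (orient-false-reverses {W} xv)
      (trans (qpage-sym y x) eq)

  centre-degree : HasDegree (Q S) (inj₁ zero) n
  centre-degree = mk↔ₛ′ to from (λ _ → refl) from-to
    where
    to : Neighbour (Q S) (inj₁ zero) → Fin n
    to (inj₁ _ , ())
    to (inj₂ e , _) = spoke-index e
    from : Fin n → Neighbour (Q S) (inj₁ zero)
    from j = inj₂ (spoke j) , refl
    from-to : ∀ x → from (to x) ≡ x
    from-to (inj₁ _ , ())
    from-to (inj₂ e , _) = neighbour-≡ {Q S} {inj₁ zero} (cong inj₂ (spoke-spoke-index e))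

first-spoke-degree : ∀ n → HasDegree (Q (star (suc n))) (inj₂ (QStar.spoke (suc n) zero)) (suc (suc n))
first-spoke-degree n = mk↔ₛ′ to from to-from from-to
  where
  open QStar (suc n) using (S; spoke; spoke-spoke-index)
  to : Neighbour (Q S) (inj₂ (spoke zero)) → Fin (suc (suc n))
  to (inj₁ zero             , _) = zero
  to (inj₁ (suc zero)       , _) = suc zero
  to (inj₁ (suc (suc _))    , ())
  to (inj₂ (zero , suc zero    , _ , _) , ())
  to (inj₂ (zero , suc (suc j) , _ , _) , _) = suc (suc j)
  to (inj₂ (zero  , zero  , _  , ()) , _)
  to (inj₂ (suc _ , zero  , () , _)  , _)
  to (inj₂ (suc _ , suc _ , _  , ()) , _)
  from : Fin (suc (suc n)) → Neighbour (Q S) (inj₂ (spoke zero))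
  from zero          = inj₁ zero , refl
  from (suc zero)    = inj₁ (suc zero) , refl
  from (suc (suc j)) = inj₂ (spoke (suc j)) , refl
  to-from : ∀ i → to (from i) ≡ i
  to-from zero          = refl
  to-from (suc zero)    = refl
  to-from (suc (suc j)) = refl
  from-to : ∀ x → from (to x) ≡ x
  from-to (inj₁ zero             , _) = neighbour-≡ {Q S} {inj₂ (spoke zero)} refl
  from-to (inj₁ (suc zero)       , _) = neighbour-≡ {Q S} {inj₂ (spoke zero)} refl
  from-to (inj₁ (suc (suc _))    , ())
  from-to (inj₂ (zero , suc zero    , _ , _) , ())
  from-to (inj₂ e@(zero , suc (suc j) , _ , _) , _) =
    neighbour-≡ {Q S} {inj₂ (spoke zero)} (cong inj₂ (spoke-spoke-index e))
  from-to (inj₂ (zero  , zero  , _  , ()) , _)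
  from-to (inj₂ (suc _ , zero  , () , _)  , _)
  from-to (inj₂ (suc _ , suc _ , _  , ()) , _)

module StarSumEmbedding (n : ℕ) {m k : ℕ} (H : FinGraph m) (colour : Fin m → Bool)
         (proper : ∀ h h' → Edge (toGraph H) h h' → colour h ≢ colour h')
         (MH : MBE (toGraph H) k) where

  open QStar n
  open MBE MH using () renaming (pos to posH; pos-inj to posH-inj; page to pageH; page-sym to pageH-sym;
                                 matching to matchingH)
  open Lexicographic W

  G : Graph
  G = star n +Q H

  offset : Fin m → QV S → ℕ
  offset h x = oslot (colour h) (node x)

  offset-< : ∀ h x → offset h x < W
  offset-< h x = orient-< (colour h) (slot-< (node x))

  pos : QSumV S H → ℕ
  pos (x , h) = posH h * W + offset h x

  pos-injective : ∀ u w → pos u ≡ pos w → u ≡ w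
  pos-injective (x , h) (y , h') eq with lex-injective (offset-< h x) (offset-< h' y) eq
  ... | posH≡ , offset≡ with posH-inj h h' posH≡
  ...   | refl = cong (_, h) (node-injective (slot-injective
                   (orient-injective (colour h) (slot-< (node x)) (slot-< (node y)) offset≡)))

  same-fibre : ∀ {x y z h g} → pos (x , h) < pos (z , g) → pos (z , g) < pos (y , h) → g ≡ h
  same-fibre {x} {y} {z} {h} {g} lt₁ lt₂ =
    posH-inj g h (lex-between (offset-< h x) (offset-< g z) (offset-< h y) lt₁ lt₂)

  fibre-< : ∀ h x y → pos (x , h) < pos (y , h) → offset h x < offset h y
  fibre-< h x y = +-cancelˡ-< (posH h * W) (offset h x) (offset h y)

  data SumEdge : QSumV S H → QSumV S H → Set where
    fibre : ∀ {x y} h → QEdge (node x) (node y) → SumEdge (x , h) (y , h)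
    copy  : ∀ v {h h'} → Edge (toGraph H) h h' → SumEdge (inj₁ v , h) (inj₁ v , h')

  copy-edge : ∀ x y {h h'} → sameV {G = S} x y ∧ fadj H h h' ≡ true → SumEdge (x , h) (y , h')
  copy-edge (inj₁ v) (inj₁ w) p with ∧-true⁻ {eqb v w} p
  ... | v≡w , e with eqb⇒≡ v≡w
  ...   | refl = copy v e
  copy-edge (inj₁ _) (inj₂ _) ()
  copy-edge (inj₂ _) (inj₁ _) ()
  copy-edge (inj₂ _) (inj₂ _) ()

  sum-edge : ∀ u w → Edge G u w → SumEdge u w
  sum-edge (x , h) (y , h') e with ∨-true⁻ {sameV {G = S} x y ∧ fadj H h h'} e
  ... | inj₁ p = copy-edge x y p
  ... | inj₂ p with ∧-true⁻ {eqb h h'} p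
  ...   | h≡h' , q with eqb⇒≡ h≡h'
  ...     | refl = fibre h (qedge x y q)

  hpage : Fin N → Fin k → ℕ
  hpage v zero    = idx (vnode v)
  hpage v (suc q) = N + toℕ q

  edge-page : ∀ {u w} → SumEdge u w → ℕ
  edge-page (fibre {x} {y} _ _) = qpage (node x) (node y)
  edge-page (copy v {h} {h'} e) = hpage v (pageH h h' e)

  page : ∀ u w → Edge G u w → ℕ
  page u w e = edge-page (sum-edge u w e)

  D : ℕ
  D = N + pred k

  qpage-< : ∀ x y → qpage x y < N
  qpage-< x y = m%n<n (idx x + idx y) N

  hpage-< : ∀ v q → hpage v q < D
  hpage-< v zero    = <-≤-trans (idx-< (vnode v)) (m≤m+n N _)
  hpage-< v (suc q) = +-monoʳ-< N (toℕ<n q)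

  page-< : ∀ u w (e : Edge G u w) → page u w e < D
  page-< u w e with sum-edge u w e
  ... | fibre {x} {y} _ _ = <-≤-trans (qpage-< (node x) (node y)) (m≤m+n N _)
  ... | copy v {h} {h'} e' = hpage-< v (pageH h h' e')

  hpage-injective : ∀ {v v'} p p' → hpage v p ≡ hpage v' p' → p ≡ p'
  hpage-injective zero    zero     _  = refl
  hpage-injective {v} zero (suc _) eq = contradiction eq (<⇒≢ (<-≤-trans (idx-< (vnode v)) (m≤m+n N _)))
  hpage-injective {v' = v'} (suc _) zero eq =
    contradiction eq (>⇒≢ (<-≤-trans (idx-< (vnode v')) (m≤m+n N _)))
  hpage-injective (suc q) (suc q') eq = cong suc (toℕ-injective (+-cancelˡ-≡ N _ _ eq))

  qpage≡hpage⇒ : ∀ {x y} v p → qpage x y ≡ hpage v p → qpage x y ≡ idx (vnode v)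
  qpage≡hpage⇒         v zero    eq = eq
  qpage≡hpage⇒ {x} {y} v (suc q) eq = contradiction eq (<⇒≢ (<-≤-trans (qpage-< x y) (m≤m+n N _)))

  page-sym : ∀ u w (e : Edge G u w) (e' : Edge G w u) → page u w e ≡ page w u e'
  page-sym u w e e' with sum-edge u w e | sum-edge w u e'
  ... | fibre {x} {y} _ _ | fibre _ _  = qpage-sym (node x) (node y)
  ... | copy v {h} {h'} p | copy _ p'  = cong (hpage v) (pageH-sym h h' p p')
  ... | fibre h _         | copy _ p'  = contradiction p' (Edge-irrefl {toGraph H} h)
  ... | copy _ {h} p      | fibre _ _  = contradiction p (Edge-irrefl {toGraph H} h)

  matching : ∀ u v w (e : Edge G u v) (e' : Edge G u w) → page u v e ≡ page u w e' → v ≡ w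
  matching u v w e e' with sum-edge u v e | sum-edge u w e'
  ... | fibre h q | fibre _ q' = λ eq → cong (_, h) (node-injective (qpage-matching q q' eq))
  ... | copy t {h} {h'} p | copy _ {_} {h''} p' =
          λ eq → cong (inj₁ t ,_) (matchingH h h' h'' p p' (hpage-injective _ _ eq))
  ... | fibre {y = y} _ q | copy t {h} {h'} p = λ eq →
          ⊥-elim (qpage-avoids-vertex t q (qpage≡hpage⇒ {vnode t} {node y} t (pageH h h' p) eq))
  ... | copy t {h} {h'} p | fibre {y = y} _ q = λ eq →
          ⊥-elim (qpage-avoids-vertex t q (qpage≡hpage⇒ {vnode t} {node y} t (pageH h h' p) (sym eq)))

  fibre-fibre : ∀ {x y z w h g} → QEdge (node x) (node y) → QEdge (node z) (node w) →
                pos (x , h) < pos (z , g) → pos (z , g) < pos (y , h) → pos (y , h) < pos (w , g) →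
                qpage (node x) (node y) ≢ qpage (node z) (node w)
  fibre-fibre {x} {y} {z} {w} {h} q q' ab bc cd with same-fibre {x} {y} {z} ab bc
  ... | refl = oriented-noncrossing (colour h) q q'
                 (fibre-< h x z ab) (fibre-< h z y bc) (fibre-< h y w cd)

  fibre-copy : ∀ {x y h v g} p → QEdge (node x) (node y) →
               pos (x , h) < pos (inj₁ v , g) → pos (inj₁ v , g) < pos (y , h) →
               qpage (node x) (node y) ≢ hpage v p
  fibre-copy {x} {y} {h} {v} p q ab bc eq with same-fibre {x} {y} {inj₁ v} ab bc
  ... | refl = oriented-nonseparating (colour h) v q
                 (fibre-< h x (inj₁ v) ab) (fibre-< h (inj₁ v) y bc) (qpage≡hpage⇒ {node x} {node y} v p eq)

  copy-copy : ∀ {v v' h h' g g'} (p : Edge (toGraph H) h h') (p' : Edge (toGraph H) g g') →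
              pos (inj₁ v , h) < pos (inj₁ v' , g) → pos (inj₁ v' , g) < pos (inj₁ v , h') →
              pos (inj₁ v , h') < pos (inj₁ v' , g') → hpage v (pageH h h' p) ≢ hpage v' (pageH g g' p')
  copy-copy {v} {v'} {h} {h'} {g} {g'} p p' ab bc cd eq
    with same-page-weakly-crossing MH h g h' g' p p'
           (lex-≤ (offset-< h (inj₁ v)) (offset-< g (inj₁ v')) ab)
           (lex-≤ (offset-< g (inj₁ v')) (offset-< h' (inj₁ v)) bc)
           (lex-≤ (offset-< h' (inj₁ v)) (offset-< g' (inj₁ v')) cd) (hpage-injective _ _ eq)
  ... | refl , refl = orient-opposite (proper h h' p) (fibre-< h (inj₁ v) (inj₁ v') ab)
                        (fibre-< h' (inj₁ v) (inj₁ v') cd)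

  noncross : ∀ a b c d (e : Edge G a c) (e' : Edge G b d) →
             pos a < pos b → pos b < pos c → pos c < pos d → page a c e ≢ page b d e'
  noncross a b c d e e' ab bc cd with sum-edge a c e | sum-edge b d e'
  ... | fibre {x} {y} _ q  | fibre {z} {w} _ q' = fibre-fibre {x} {y} {z} {w} q q' ab bc cd
  ... | fibre {x} {y} _ q  | copy _ {g} {g'} p' = fibre-copy {x} {y} (pageH g g' p') q ab bc
  ... | copy _ {g} {g'} p  | fibre {z} {w} _ q' = fibre-copy {z} {w} (pageH g g' p) q' bc cd ∘ sym
  ... | copy _ p           | copy _ p'          = copy-copy p p' ab bc cd

  embedding : MBE G D
  embedding = MBEℕ⇒MBE record
    { pos = pos ; pos-inj = pos-injective ; page = page ; page-< = page-<
    ; page-sym = page-sym ; matching = matching ; noncross = noncross }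

theorem3p3 : (n : ℕ) → 1 ≤ n → {m : ℕ} (H : FinGraph m) →
             Bipartite (toGraph H) → Dispersable (toGraph H) →
             Dispersable (star n +Q H)
theorem3p3 zero    ()
theorem3p3 (suc n) _ {zero}  H _ _ = dispersable-empty λ { (_ , ()) }
theorem3p3 (suc n) _ {suc _} H (colour , proper) (zero , _ , MH , _) =
  dispersable-by embedding v (subst (HasDegree G v) (sym (+-identityʳ _)) degree)
  where
  open StarSumEmbedding (suc n) H colour proper MH
  v : QSumV (star (suc n)) H
  v = inj₂ (QStar.spoke (suc n) zero) , zero
  degree : HasDegree G v (suc (suc n))
  degree = +Q-edge-degree (star (suc n)) H (first-spoke-degree n)
theorem3p3 (suc n) _ {suc _} H (colour , proper) (suc k , (_ , inj₂ (h , degH)) , MH , _) =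
  dispersable-by embedding v (subst (HasDegree G v) (+-suc (suc n) k) degree)
  where
  open StarSumEmbedding (suc n) H colour proper MH
  v : QSumV (star (suc n)) H
  v = inj₁ zero , h
  degree : HasDegree G v (suc n + suc k)
  degree = +Q-vertex-degree (star (suc n)) H (QStar.centre-degree (suc n)) degH
theorem3p3 (suc n) _ {suc _} H _ (suc k , (_ , inj₁ ()) , _)
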